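{- Let $T$ be a tree rooted in a vertex $r$ and $\tau$ a threshold function for $T$. For every vertex $u$ of $T$ and every non-negative integer $b\leq n(T_u)$ there is a set $X\subseteq V(T_u)$ with $|X|=b$ such that simultaneously ${\rm dyn}(T_u,\tau_X)={\rm vacc}_1(T_u,\tau,b)$ and ${\rm dyn}(T_u,\tau^u_X)={\rm vacc}_1(T_u,\tau^u,b)$.
   Context: A threshold function for a graph $G$ is a function $\tau:U\to\mathbb{Z}\cup\{\infty\}$ whose domain $U$ contains $V(G)$. For $D\subseteq V(G)$, the hull $H_{(G,\tau)}(D)$ is the smallest $H\subseteq V(G)$ with $D\subseteq H$ and $u\in H$ for every vertex $u$ with $|H\cap N_G(u)|\geq\tau(u)$; $D$ is a dynamic monopoly if $H_{(G,\tau)}(D)=V(G)$; ${\rm dyn}(G,\tau)$ is the minimum order of a dynamic monopoly. For a set $X$, $\tau_X$ equals $\tau$ on $U\setminus X$ and $\infty$ on $U\cap X$. For a vertex $u$, $\tau^u$ equals $\tau$ except $\tau^u(u)=\tau(u)-1$; $\tau^u_X=(\tau^u)_X$. ${\rm vacc}_1(G,\tau,b)=\max\{{\rm dyn}(G,\tau_X):X\subseteq V(G),|X|=b\}$. $T_u$ is the subtree of $T$ induced by $u$ and its descendants and $n(T_u)$ its order. -}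

module Defs where

open import Data.Nat using (ℕ; zero; suc; _≤_)
open import Data.Integer using (ℤ; +_; _-_) renaming (_≤_ to _≤ℤ_)
open import Data.Bool using (Bool; true; false; _∧_; _∨_; not; if_then_else_)
open import Data.Fin using (Fin; _≟_)
open import Data.Fin.Subset using (Subset; _∈_; _⊆_; _∩_; ∣_∣)
open import Data.Vec using (tabulate; lookup)
open import Data.Empty using (⊥)
open import Data.Product using (Σ; _×_; ∃)
open import Relation.Nullary.Decidable using (⌊_⌋)
open import Relation.Binary.PropositionalEquality using (_≡_)

data Thr : Set where
  fin : ℤ → Thr
  ∞   : Thr

_≥ᵗ_ : ℕ → Thr → Set
k ≥ᵗ fin z = z ≤ℤ + k
k ≥ᵗ ∞     = ⊥

pred∞ : Thr → Thr
pred∞ (fin z) = fin (z - + 1)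
pred∞ ∞       = ∞

Threshold : ℕ → Set
Threshold n = Fin n → Thr

_[∞_] : ∀ {n} → Threshold n → Subset n → Threshold n
(τ [∞ X ]) v = if lookup X v then ∞ else τ v

_^_ : ∀ {n} → Threshold n → Fin n → Threshold n
(τ ^ u) v = if ⌊ v ≟ u ⌋ then pred∞ (τ u) else τ v

-- Graphs: decidable adjacency on Fin n, considered as the graph induced
-- on a vertex set S ⊆ Fin n.

Adj : ℕ → Set
Adj n = Fin n → Fin n → Bool

nbhd : ∀ {n} → Adj n → Subset n → Fin n → Subset n
nbhd adj S v = tabulate (λ w → adj v w ∧ lookup S w)

Closed : ∀ {n} → Adj n → Subset n → Threshold n → Subset n → Subset n → Set
Closed adj S τ D H =
  D ⊆ H × H ⊆ S ×
  (∀ u → u ∈ S → ∣ H ∩ nbhd adj S u ∣ ≥ᵗ τ u → u ∈ H)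

IsHull : ∀ {n} → Adj n → Subset n → Threshold n → Subset n → Subset n → Set
IsHull adj S τ D H =
  Closed adj S τ D H × (∀ H′ → Closed adj S τ D H′ → H ⊆ H′)

IsDynMon : ∀ {n} → Adj n → Subset n → Threshold n → Subset n → Set
IsDynMon adj S τ D = D ⊆ S × (∀ H → IsHull adj S τ D H → H ≡ S)

IsDyn : ∀ {n} → Adj n → Subset n → Threshold n → ℕ → Set
IsDyn adj S τ k =
  (Σ (Subset _) λ D → IsDynMon adj S τ D × ∣ D ∣ ≡ k) ×
  (∀ D → IsDynMon adj S τ D → k ≤ ∣ D ∣)

IsVacc₁ : ∀ {n} → Adj n → Subset n → Threshold n → ℕ → ℕ → Set
IsVacc₁ adj S τ b k =
  (Σ (Subset _) λ X → X ⊆ S × ∣ X ∣ ≡ b × IsDyn adj S (τ [∞ X ]) k) ×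
  (∀ X k′ → X ⊆ S → ∣ X ∣ ≡ b → IsDyn adj S (τ [∞ X ]) k′ → k′ ≤ k)

-- Rooted trees on Fin n, given by a parent map.

iter : ∀ {n} → (Fin n → Fin n) → ℕ → Fin n → Fin n
iter p zero    v = v
iter p (suc k) v = p (iter p k v)

-- p is the parent map of a tree rooted at r: p r = r and every vertex
-- reaches r by iterating p (so there are no other cycles).
IsRootedTree : ∀ {n} → Fin n → (Fin n → Fin n) → Set
IsRootedTree r p = p r ≡ r × (∀ v → ∃ λ k → iter p k v ≡ r)

treeAdj : ∀ {n} → Fin n → (Fin n → Fin n) → Adj n
treeAdj r p v w =
  (not ⌊ v ≟ r ⌋ ∧ ⌊ p v ≟ w ⌋) ∨ (not ⌊ w ≟ r ⌋ ∧ ⌊ p w ≟ v ⌋)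

reachWithin : ∀ {n} → (Fin n → Fin n) → ℕ → Fin n → Fin n → Bool
reachWithin p zero    u w = ⌊ w ≟ u ⌋
reachWithin p (suc k) u w = reachWithin p k u w ∨ ⌊ iter p (suc k) w ≟ u ⌋

-- V(T_u): u and its descendants (paths to the root have < n steps)
subtree : ∀ {n} → (Fin n → Fin n) → Fin n → Subset n
subtree {n} p u = tabulate (reachWithin p n u)

-- Put f X = dyn(G, τ_X) and g X = dyn(G, τ^u_X). Lowering one threshold can only help, so
-- g ≤ f; and a dynamic monopoly for τ^u_X together with u is one for τ_X, so f ≤ g + 1.
-- Take X₁ maximising f and X₂ maximising g over the b-subsets. If neither maximises the
-- other function, then f X₂ < f X₁ ≤ g X₁ + 1 ≤ g X₂ ≤ f X₂, which is absurd. Nothing about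
-- trees is used: the statement holds for every finite graph and every vertex u.
module Submission where

open import Defs
open import Data.Nat using (ℕ; zero; suc; _+_; _≤_; _<_; z≤n; s≤s; _≤?_)
open import Data.Nat.Properties
  using (≤-refl; ≤-reflexive; ≤-trans; ≰⇒>; ≤∧≢⇒<; <-irrefl; +-suc; +-comm; +-monoʳ-≤; n≤1+n; module ≤-Reasoning)
  renaming (_≟_ to _≟ℕ_)
open import Data.Integer using (+_; +≤+)
open import Data.Integer.Properties using (i≤j⇒i-k≤j) renaming (≤-trans to ≤ℤ-trans; _≤?_ to _≤ℤ?_)
open import Data.Bool using (Bool; true; false; _∨_)
open import Data.Bool.Properties using (T-≡) renaming (_≟_ to _≟𝔹_)
open import Data.Fin using (Fin; _≟_)
open import Data.Fin.Properties using (all?)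
open import Data.Fin.Subset using (Subset; _∈_; _∉_; _⊆_; _∩_; _∪_; ⁅_⁆; ∣_∣; ⊥; inside; outside)
open import Data.Fin.Subset.Properties
  using (_∈?_; _⊆?_; anySubset?; ⊆-antisym; p⊆q⇒∣p∣≤∣q∣; x∈p∩q⁺; x∈p∩q⁻; x∈p∪q⁻;
         p⊆p∪q; q⊆p∪q; x∈⁅y⁆⇒x≡y; x∉⁅y⁆⇒x≢y; s⊆s; ∉⊥; ∣⊥∣≡0; ∣⁅x⁆∣≡1)
open import Data.Vec using (_∷_; []; lookup; tabulate)
open import Data.Vec.Properties using (lookup∘tabulate; lookup⇒[]=; []=⇒lookup; ≡-dec)
open import Data.Product using (Σ; _×_; ∃; _,_; proj₁; proj₂)
open import Data.Sum using ([_,_])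
open import Data.Empty using (⊥-elim)
open import Function using (_∘_; id; Equivalence)
open import Relation.Nullary using (Dec; yes; no; contradiction)
open import Relation.Nullary.Decidable using (_×-dec_; _→-dec_; ¬?; decidable-stable; isYes; toWitness; fromWitness)
open import Relation.Binary.PropositionalEquality using (_≡_; refl; sym; trans; subst; cong)

∈-tabulate⁺ : ∀ {n} (f : Fin n → Bool) {v} → f v ≡ true → v ∈ tabulate f
∈-tabulate⁺ f {v} fv = lookup⇒[]= v (tabulate f) (trans (lookup∘tabulate f v) fv)

∈-tabulate⁻ : ∀ {n} (f : Fin n → Bool) {v} → v ∈ tabulate f → f v ≡ true
∈-tabulate⁻ f {v} v∈ = trans (sym (lookup∘tabulate f v)) ([]=⇒lookup v∈)

∀-subset? : ∀ {n} {P : Subset n → Set} → (∀ X → Dec (P X)) → Dec (∀ X → P X)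
∀-subset? {P = P} P? with anySubset? (λ X → ¬? (P? X))
... | yes (X , ¬PX) = no λ ∀P → ¬PX (∀P X)
... | no ∄¬P = yes λ X → decidable-stable (P? X) (λ ¬PX → ∄¬P (X , ¬PX))

∣p∪q∣≤∣p∣+∣q∣ : ∀ {n} (p q : Subset n) → ∣ p ∪ q ∣ ≤ ∣ p ∣ + ∣ q ∣
∣p∪q∣≤∣p∣+∣q∣ []            []            = z≤n
∣p∪q∣≤∣p∣+∣q∣ (outside ∷ p) (outside ∷ q) = ∣p∪q∣≤∣p∣+∣q∣ p q
∣p∪q∣≤∣p∣+∣q∣ (inside ∷ p)  (outside ∷ q) = s≤s (∣p∪q∣≤∣p∣+∣q∣ p q)
∣p∪q∣≤∣p∣+∣q∣ (outside ∷ p) (inside ∷ q)  =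
  subst (suc ∣ p ∪ q ∣ ≤_) (sym (+-suc ∣ p ∣ ∣ q ∣)) (s≤s (∣p∪q∣≤∣p∣+∣q∣ p q))
∣p∪q∣≤∣p∣+∣q∣ (inside ∷ p)  (inside ∷ q)  =
  s≤s (≤-trans (∣p∪q∣≤∣p∣+∣q∣ p q) (+-monoʳ-≤ ∣ p ∣ (n≤1+n ∣ q ∣)))

∪-⊆ : ∀ {n} {p q r : Subset n} → p ⊆ r → q ⊆ r → p ∪ q ⊆ r
∪-⊆ {p = p} {q} p⊆r q⊆r x∈p∪q = [ p⊆r , q⊆r ] (x∈p∪q⁻ p q x∈p∪q)

subset-of-size : ∀ {n} (S : Subset n) b → b ≤ ∣ S ∣ → Σ (Subset n) λ X → X ⊆ S × ∣ X ∣ ≡ b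
subset-of-size [] zero _ = [] , id , refl
subset-of-size {suc n} (inside ∷ S) zero _ = ⊥ , ⊥-elim ∘ ∉⊥ , ∣⊥∣≡0 (suc n)
subset-of-size (inside ∷ S) (suc b) (s≤s b≤∣S∣) with subset-of-size S b b≤∣S∣
... | X , X⊆S , ∣X∣≡b = inside ∷ X , s⊆s X⊆S , cong suc ∣X∣≡b
subset-of-size (outside ∷ S) b b≤∣S∣ with subset-of-size S b b≤∣S∣
... | X , X⊆S , ∣X∣≡b = outside ∷ X , s⊆s X⊆S , ∣X∣≡b

Minimiser : {A : Set} → (A → Set) → (A → ℕ) → A → Set
Minimiser Q f x = Q x × (∀ y → Q y → f x ≤ f y)

Maximiser : {A : Set} → (A → Set) → (A → ℕ) → A → Set
Maximiser Q f x = Q x × (∀ y → Q y → f y ≤ f x)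

minimiser : ∀ {n} {Q : Subset n → Set} → (∀ X → Dec (Q X)) → (f : Subset n → ℕ) →
            ∀ m → (Σ (Subset n) λ X → Q X × f X ≤ m) → Σ (Subset n) (Minimiser Q f)
minimiser Q? f zero (X , QX , fX≤0) = X , QX , λ _ _ → ≤-trans fX≤0 z≤n
minimiser Q? f (suc m) (X , QX , fX≤1+m) with anySubset? (λ Y → Q? Y ×-dec (f Y ≤? m))
... | yes below = minimiser Q? f m below
... | no ∄below = X , QX , λ Y QY → ≤-trans fX≤1+m (≰⇒> (λ fY≤m → ∄below (Y , QY , fY≤m)))

maximiser : ∀ {n} {Q : Subset n → Set} → (∀ X → Dec (Q X)) → (f : Subset n → ℕ) →
            ∀ m → (∀ X → Q X → f X ≤ m) → Σ (Subset n) Q → Σ (Subset n) (Maximiser Q f)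
maximiser Q? f zero f≤0 (X , QX) = X , QX , λ Y QY → ≤-trans (f≤0 Y QY) z≤n
maximiser {Q = Q} Q? f (suc m) f≤1+m QX with anySubset? (λ Y → Q? Y ×-dec (suc m ≤? f Y))
... | yes (X , QX′ , 1+m≤fX) = X , QX′ , λ Y QY → ≤-trans (f≤1+m Y QY) 1+m≤fX
... | no ∄above = maximiser Q? f m f≤m QX
  where
  f≤m : ∀ X → Q X → f X ≤ m
  f≤m X QX′ with f X ≤? m
  ... | yes fX≤m = fX≤m
  ... | no fX≰m = ⊥-elim (∄above (X , QX′ , ≰⇒> fX≰m))

common-maximiser : {A : Set} {Q : A → Set} (f g : A → ℕ) →
  (∀ x → Q x → g x ≤ f x) → (∀ x → Q x → f x ≤ suc (g x)) →
  ∀ {x₁ x₂} → Maximiser Q f x₁ → Maximiser Q g x₂ →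
  Σ A λ x → Maximiser Q f x × Maximiser Q g x
common-maximiser f g g≤f f≤1+g {x₁} {x₂} (Qx₁ , f≤fx₁) (Qx₂ , g≤gx₂)
  with g x₁ ≟ℕ g x₂ | f x₂ ≟ℕ f x₁
... | yes gx₁≡gx₂ | _ = x₁ , (Qx₁ , f≤fx₁) , (Qx₁ , λ y Qy → subst (g y ≤_) (sym gx₁≡gx₂) (g≤gx₂ y Qy))
... | no _ | yes fx₂≡fx₁ = x₂ , (Qx₂ , λ y Qy → subst (f y ≤_) (sym fx₂≡fx₁) (f≤fx₁ y Qy)) , (Qx₂ , g≤gx₂)
... | no gx₁≢gx₂ | no fx₂≢fx₁ = contradiction fx₂<fx₂ (<-irrefl refl)
  where
  open ≤-Reasoning
  fx₂<fx₂ : f x₂ < f x₂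
  fx₂<fx₂ = begin-strict
    f x₂        <⟨ ≤∧≢⇒< (f≤fx₁ x₂ Qx₂) fx₂≢fx₁ ⟩
    f x₁        ≤⟨ f≤1+g x₁ Qx₁ ⟩
    suc (g x₁)  ≤⟨ ≤∧≢⇒< (g≤gx₂ x₁ Qx₁) gx₁≢gx₂ ⟩
    g x₂        ≤⟨ g≤f x₂ Qx₂ ⟩
    f x₂        ∎

_≥ᵗ?_ : ∀ k t → Dec (k ≥ᵗ t)
k ≥ᵗ? fin z = z ≤ℤ? + k
k ≥ᵗ? ∞     = no λ ()

≥ᵗ-mono : ∀ {k k′} t → k ≤ k′ → k ≥ᵗ t → k′ ≥ᵗ t
≥ᵗ-mono (fin z) k≤k′ z≤k = ≤ℤ-trans z≤k (+≤+ k≤k′)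

≥ᵗ-pred∞ : ∀ {k} t → k ≥ᵗ t → k ≥ᵗ pred∞ t
≥ᵗ-pred∞ (fin z) z≤k = i≤j⇒i-k≤j (+ 1) z≤k

_≼_ : ∀ {n} → Threshold n → Threshold n → Set
τ ≼ τ′ = ∀ v {k} → k ≥ᵗ τ v → k ≥ᵗ τ′ v

_≼[_]_ : ∀ {n} → Threshold n → Subset n → Threshold n → Set
τ ≼[ Y ] τ′ = ∀ v {k} → v ∉ Y → k ≥ᵗ τ v → k ≥ᵗ τ′ v

≼-[∞] : ∀ {n} {τ τ′ : Threshold n} X → τ ≼ τ′ → (τ [∞ X ]) ≼ (τ′ [∞ X ])
≼-[∞] X τ≼τ′ v with lookup X v
... | true  = id
... | false = τ≼τ′ v

≼[]-[∞] : ∀ {n} {τ τ′ : Threshold n} {Y} X → τ ≼[ Y ] τ′ → (τ [∞ X ]) ≼[ Y ] (τ′ [∞ X ])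
≼[]-[∞] X τ≼τ′ v with lookup X v
... | true  = λ _ → id
... | false = τ≼τ′ v

≼-^ : ∀ {n} (τ : Threshold n) u → τ ≼ (τ ^ u)
≼-^ τ u v with v ≟ u
... | yes refl = ≥ᵗ-pred∞ (τ v)
... | no _     = id

^-≼[⁅⁆] : ∀ {n} (τ : Threshold n) u → (τ ^ u) ≼[ ⁅ u ⁆ ] τ
^-≼[⁅⁆] τ u v v∉⁅u⁆ with v ≟ u
... | yes v≡u = contradiction v≡u (x∉⁅y⁆⇒x≢y v∉⁅u⁆)
... | no _    = id

module _ {n : ℕ} (adj : Adj n) (S : Subset n) where

  closed? : ∀ τ D H → Dec (Closed adj S τ D H)
  closed? τ D H = (D ⊆? H) ×-dec (H ⊆? S) ×-dec
    all? (λ u → (u ∈? S) →-dec ((∣ H ∩ nbhd adj S u ∣ ≥ᵗ? τ u) →-dec (u ∈? H)))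

  closed-≼ : ∀ {τ τ′ D H} → τ ≼ τ′ → Closed adj S τ′ D H → Closed adj S τ D H
  closed-≼ τ≼τ′ (D⊆H , H⊆S , stable) = D⊆H , H⊆S , λ v v∈S act → stable v v∈S (τ≼τ′ v act)

  closed-∪ : ∀ {τ τ′ D Y H} → τ′ ≼[ Y ] τ → Closed adj S τ (D ∪ Y) H → Closed adj S τ′ D H
  closed-∪ {τ} {τ′} {D} {Y} {H} τ′≼τ (D∪Y⊆H , H⊆S , stable) = D∪Y⊆H ∘ p⊆p∪q Y , H⊆S , stable′
    where
    stable′ : ∀ v → v ∈ S → ∣ H ∩ nbhd adj S v ∣ ≥ᵗ τ′ v → v ∈ H
    stable′ v v∈S act with v ∈? Y
    ... | yes v∈Y = D∪Y⊆H (q⊆p∪q D Y v∈Y)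
    ... | no v∉Y  = stable v v∈S (τ′≼τ v v∉Y act)

  inAllClosed? : ∀ τ D v → Dec (∀ H → Closed adj S τ D H → v ∈ H)
  inAllClosed? τ D v = ∀-subset? (λ H → closed? τ D H →-dec (v ∈? H))

  hull : Threshold n → Subset n → Subset n
  hull τ D = tabulate (isYes ∘ inAllClosed? τ D)

  ∈-hull⁺ : ∀ {τ D v} → (∀ H → Closed adj S τ D H → v ∈ H) → v ∈ hull τ D
  ∈-hull⁺ {τ} {D} {v} inAll = ∈-tabulate⁺ _ (Equivalence.to T-≡ (fromWitness {a? = inAllClosed? τ D v} inAll))

  ∈-hull⁻ : ∀ {τ D v} → v ∈ hull τ D → ∀ H → Closed adj S τ D H → v ∈ H
  ∈-hull⁻ {τ} {D} {v} v∈hull =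
    toWitness {a? = inAllClosed? τ D v} (Equivalence.from T-≡ (∈-tabulate⁻ _ v∈hull))

  hull-isHull : ∀ τ D → D ⊆ S → IsHull adj S τ D (hull τ D)
  hull-isHull τ D D⊆S = (D⊆hull , hull⊆S , stable) , λ H closed v∈hull → ∈-hull⁻ v∈hull H closed
    where
    D⊆hull : D ⊆ hull τ D
    D⊆hull v∈D = ∈-hull⁺ λ H closed → proj₁ closed v∈D
    hull⊆S : hull τ D ⊆ S
    hull⊆S v∈hull = ∈-hull⁻ v∈hull S (D⊆S , id , λ _ v∈S _ → v∈S)
    stable : ∀ v → v ∈ S → ∣ hull τ D ∩ nbhd adj S v ∣ ≥ᵗ τ v → v ∈ hull τ D
    stable v v∈S act = ∈-hull⁺ λ H closed@(_ , _ , H-stable) →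
      let hull∩N⊆H∩N : hull τ D ∩ nbhd adj S v ⊆ H ∩ nbhd adj S v
          hull∩N⊆H∩N w∈ = let w∈hull , w∈N = x∈p∩q⁻ _ _ w∈ in x∈p∩q⁺ (∈-hull⁻ w∈hull H closed , w∈N)
      in H-stable v v∈S (≥ᵗ-mono (τ v) (p⊆q⇒∣p∣≤∣q∣ hull∩N⊆H∩N) act)

  dynMon? : ∀ τ D → Dec (IsDynMon adj S τ D)
  dynMon? τ D = (D ⊆? S) ×-dec ∀-subset? (λ H → isHull? H →-dec ≡-dec _≟𝔹_ H S)
    where
    isHull? : ∀ H → Dec (IsHull adj S τ D H)
    isHull? H = closed? τ D H ×-dec ∀-subset? (λ H′ → closed? τ D H′ →-dec (H ⊆? H′))

  dynMon-closed : ∀ {τ D H} → IsDynMon adj S τ D → Closed adj S τ D H → S ⊆ H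
  dynMon-closed {τ} {D} {H} (D⊆S , hull≡S) closed v∈S =
    proj₂ isHull H closed (subst (_ ∈_) (sym (hull≡S _ isHull)) v∈S)
    where
    isHull : IsHull adj S τ D (hull τ D)
    isHull = hull-isHull τ D D⊆S

  closed-dynMon : ∀ {τ D} → D ⊆ S → (∀ H → Closed adj S τ D H → S ⊆ H) → IsDynMon adj S τ D
  closed-dynMon D⊆S S⊆closed = D⊆S , λ H (H-closed@(_ , H⊆S , _) , _) →
    ⊆-antisym H⊆S (S⊆closed H H-closed)

  dynMon-≼ : ∀ {τ τ′ D} → τ ≼ τ′ → IsDynMon adj S τ D → IsDynMon adj S τ′ D
  dynMon-≼ τ≼τ′ dm = closed-dynMon (proj₁ dm) λ _ closed → dynMon-closed dm (closed-≼ τ≼τ′ closed)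

  dynMon-∪ : ∀ {τ τ′ D Y} → Y ⊆ S → τ′ ≼[ Y ] τ → IsDynMon adj S τ′ D → IsDynMon adj S τ (D ∪ Y)
  dynMon-∪ Y⊆S τ′≼τ dm = closed-dynMon (∪-⊆ (proj₁ dm) Y⊆S) λ _ closed → dynMon-closed dm (closed-∪ τ′≼τ closed)

  S-dynMon : ∀ τ → IsDynMon adj S τ S
  S-dynMon τ = closed-dynMon id λ _ (S⊆H , _) → S⊆H

  -- abstract, so that unification never unfolds the exhaustive search over subsets
  abstract
    smallestDynMon : ∀ τ → Σ (Subset n) (Minimiser (IsDynMon adj S τ) ∣_∣)
    smallestDynMon τ = minimiser (dynMon? τ) ∣_∣ ∣ S ∣ (S , S-dynMon τ , ≤-refl)

  dyn : Threshold n → ℕ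
  dyn τ = ∣ proj₁ (smallestDynMon τ) ∣

  dyn-≤ : ∀ {τ D} → IsDynMon adj S τ D → dyn τ ≤ ∣ D ∣
  dyn-≤ {τ} {D} = proj₂ (proj₂ (smallestDynMon τ)) D

  dyn-isDyn : ∀ τ → IsDyn adj S τ (dyn τ)
  dyn-isDyn τ = (proj₁ (smallestDynMon τ) , proj₁ (proj₂ (smallestDynMon τ)) , refl) , λ _ → dyn-≤

  isDyn⇒≤dyn : ∀ {τ k} → IsDyn adj S τ k → k ≤ dyn τ
  isDyn⇒≤dyn {τ} (_ , k≤) = k≤ _ (proj₁ (proj₂ (smallestDynMon τ)))

  dyn-antitone : ∀ {τ τ′} → τ ≼ τ′ → dyn τ′ ≤ dyn τ
  dyn-antitone {τ} τ≼τ′ = dyn-≤ (dynMon-≼ τ≼τ′ (proj₁ (proj₂ (smallestDynMon τ))))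

  dyn-≤-+ : ∀ {τ τ′ Y} → Y ⊆ S → τ′ ≼[ Y ] τ → dyn τ ≤ dyn τ′ + ∣ Y ∣
  dyn-≤-+ {τ′ = τ′} {Y} Y⊆S τ′≼τ =
    ≤-trans (dyn-≤ (dynMon-∪ Y⊆S τ′≼τ (proj₁ (proj₂ (smallestDynMon τ′)))))
            (∣p∪q∣≤∣p∣+∣q∣ (proj₁ (smallestDynMon τ′)) Y)

  OfSize : ℕ → Subset n → Set
  OfSize b X = X ⊆ S × ∣ X ∣ ≡ b

  maximiser⇒isVacc₁ : ∀ σ b {X} → Maximiser (OfSize b) (λ Y → dyn (σ [∞ Y ])) X →
                      IsVacc₁ adj S σ b (dyn (σ [∞ X ]))
  maximiser⇒isVacc₁ σ b {X} ((X⊆S , ∣X∣≡b) , max) =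
    (X , X⊆S , ∣X∣≡b , dyn-isDyn _) ,
    λ Y _ Y⊆S ∣Y∣≡b isDyn → ≤-trans (isDyn⇒≤dyn isDyn) (max Y (Y⊆S , ∣Y∣≡b))

  maximiser-dyn : ∀ σ b → b ≤ ∣ S ∣ → Σ (Subset n) (Maximiser (OfSize b) (λ X → dyn (σ [∞ X ])))
  maximiser-dyn σ b b≤∣S∣ = maximiser (λ X → (X ⊆? S) ×-dec (∣ X ∣ ≟ℕ b)) _ ∣ S ∣
    (λ _ _ → dyn-≤ (S-dynMon _)) (subset-of-size S b b≤∣S∣)

  dyn-^-≤ : ∀ τ u X → dyn ((τ ^ u) [∞ X ]) ≤ dyn (τ [∞ X ])
  dyn-^-≤ τ u X = dyn-antitone (≼-[∞] X (≼-^ τ u))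

  dyn-≤-suc-^ : ∀ τ {u} → u ∈ S → ∀ X → dyn (τ [∞ X ]) ≤ suc (dyn ((τ ^ u) [∞ X ]))
  dyn-≤-suc-^ τ {u} u∈S X = ≤-trans (dyn-≤-+ ⁅u⁆⊆S (≼[]-[∞] X (^-≼[⁅⁆] τ u))) (≤-reflexive g+∣⁅u⁆∣≡1+g)
    where
    ⁅u⁆⊆S : ⁅ u ⁆ ⊆ S
    ⁅u⁆⊆S v∈⁅u⁆ = subst (_∈ S) (sym (x∈⁅y⁆⇒x≡y u v∈⁅u⁆)) u∈S

    g : ℕ
    g = dyn ((τ ^ u) [∞ X ])
    g+∣⁅u⁆∣≡1+g : g + ∣ ⁅ u ⁆ ∣ ≡ suc g
    g+∣⁅u⁆∣≡1+g = trans (cong (λ m → g + m) (∣⁅x⁆∣≡1 u)) (+-comm g 1)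

  simultaneous-vacc₁ : ∀ τ u → u ∈ S → ∀ b → b ≤ ∣ S ∣ →
    Σ (Subset n) λ X → X ⊆ S × ∣ X ∣ ≡ b ×
      (∃ λ k → IsDyn adj S (τ [∞ X ]) k × IsVacc₁ adj S τ b k) ×
      (∃ λ k → IsDyn adj S ((τ ^ u) [∞ X ]) k × IsVacc₁ adj S (τ ^ u) b k)
  simultaneous-vacc₁ τ u u∈S b b≤∣S∣
    with common-maximiser (λ X → dyn (τ [∞ X ])) (λ X → dyn ((τ ^ u) [∞ X ]))
           (λ X _ → dyn-^-≤ τ u X) (λ X _ → dyn-≤-suc-^ τ u∈S X)
           (proj₂ (maximiser-dyn τ b b≤∣S∣)) (proj₂ (maximiser-dyn (τ ^ u) b b≤∣S∣))
  ... | X , maxf@((X⊆S , ∣X∣≡b) , _) , maxg =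
    X , X⊆S , ∣X∣≡b , (_ , dyn-isDyn _ , maximiser⇒isVacc₁ τ b maxf) ,
                      (_ , dyn-isDyn _ , maximiser⇒isVacc₁ (τ ^ u) b maxg)

reachWithin-refl : ∀ {n} (p : Fin n → Fin n) u k → reachWithin p k u u ≡ true
reachWithin-refl p u zero    = Equivalence.to T-≡ (fromWitness {a? = u ≟ u} refl)
reachWithin-refl p u (suc k) = cong (_∨ isYes (iter p (suc k) u ≟ u)) (reachWithin-refl p u k)

corollary4 : (n : ℕ) (r : Fin n) (p : Fin n → Fin n) → IsRootedTree r p →
    (τ : Threshold n) (u : Fin n) (b : ℕ) → b ≤ ∣ subtree p u ∣ →
    Σ (Subset n) λ X → X ⊆ subtree p u × ∣ X ∣ ≡ b ×
      (∃ λ k → IsDyn (treeAdj r p) (subtree p u) (τ [∞ X ]) k ×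
               IsVacc₁ (treeAdj r p) (subtree p u) τ b k) ×
      (∃ λ k → IsDyn (treeAdj r p) (subtree p u) ((τ ^ u) [∞ X ]) k ×
               IsVacc₁ (treeAdj r p) (subtree p u) (τ ^ u) b k)
corollary4 n r p _ τ u b b≤∣Tᵤ∣ =
  simultaneous-vacc₁ (treeAdj r p) (subtree p u) τ u u∈Tᵤ b b≤∣Tᵤ∣
  where
  u∈Tᵤ : u ∈ subtree p u
  u∈Tᵤ = ∈-tabulate⁺ (reachWithin p n u) (reachWithin-refl p u n)
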